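{- Let $\mathcal{C}$ be a regular category with terminal object $\mathbf{1}$, let $X$ be an object, and let $R \rightarrowtail X \times X$ be a very weakly point surjective relation on $X$. Then every natural transformation $\tau : \mathsf{Sub} \Rightarrow \mathsf{Sub}$ has a fixpoint, i.e. there is $s \in \mathsf{Sub}(\mathbf{1})$ with $\tau_{\mathbf{1}}(s) = s$.
   Context: A regular category is a well-powered category with finite limits and images (image factorizations) that are stable under pullback. For an object $A$, $\mathsf{Sub}(A)$ is the poset of subobjects of $A$ (equivalence classes of monomorphisms into $A$); for $f : A \to B$, $f^* : \mathsf{Sub}(B) \to \mathsf{Sub}(A)$ is pullback along $f$, giving a functor $\mathsf{Sub} : \mathcal{C}^{\mathrm{op}} \to \mathbf{Set}$. A natural transformation $\tau : \mathsf{Sub} \Rightarrow \mathsf{Sub}$ (an "endomorphism of the subobject functor") thus consists of maps $\tau_A : \mathsf{Sub}(A) \to \mathsf{Sub}(A)$ with $f^* \circ \tau_B = \tau_A \circ f^*$. A relation $R \rightarrowtail X \times X$ is very weakly point surjective (vwps) if for every subobject $P \rightarrowtail X$ there is a global element $c : \mathbf{1} \to X$ with $\langle c, c\rangle^*(R) = c^*(P)$ in $\mathsf{Sub}(\mathbf{1})$. -}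

module Defs where

open import Level using (Level; _⊔_; suc)
open import Data.Product using (Σ; Σ-syntax; _×_; _,_; proj₁; proj₂)
open import Relation.Binary using (Rel; IsEquivalence)

record Category (o ℓ e : Level) : Set (suc (o ⊔ ℓ ⊔ e)) where
  infixr 9 _∘_
  infix  4 _≈_
  field
    Obj  : Set o
    _⇒_  : Obj → Obj → Set ℓ
    _≈_  : ∀ {A B} → Rel (A ⇒ B) e
    id   : ∀ {A} → A ⇒ A
    _∘_  : ∀ {A B C} → B ⇒ C → A ⇒ B → A ⇒ C
    ≈-equiv   : ∀ {A B} → IsEquivalence (_≈_ {A} {B})
    ∘-resp-≈  : ∀ {A B C} {f h : B ⇒ C} {g i : A ⇒ B} →
                f ≈ h → g ≈ i → f ∘ g ≈ h ∘ i
    identityˡ : ∀ {A B} {f : A ⇒ B} → id ∘ f ≈ f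
    identityʳ : ∀ {A B} {f : A ⇒ B} → f ∘ id ≈ f
    assoc     : ∀ {A B C D} {f : A ⇒ B} {g : B ⇒ C} {h : C ⇒ D} →
                (h ∘ g) ∘ f ≈ h ∘ (g ∘ f)

module _ {o ℓ e} (𝒞 : Category o ℓ e) where
  open Category 𝒞

  Mono : ∀ {A B} → A ⇒ B → Set (o ⊔ ℓ ⊔ e)
  Mono {A} f = ∀ {Z} (g h : Z ⇒ A) → f ∘ g ≈ f ∘ h → g ≈ h

  IsTerminal : Obj → Set (o ⊔ ℓ ⊔ e)
  IsTerminal T = ∀ A → Σ[ ! ∈ A ⇒ T ] (∀ (g : A ⇒ T) → g ≈ !)

  IsProduct : ∀ {A B P} → P ⇒ A → P ⇒ B → Set (o ⊔ ℓ ⊔ e)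
  IsProduct {A} {B} {P} p₁ p₂ =
    ∀ {Z} (f : Z ⇒ A) (g : Z ⇒ B) →
      Σ[ h ∈ Z ⇒ P ] ((p₁ ∘ h ≈ f × p₂ ∘ h ≈ g) ×
        (∀ (k : Z ⇒ P) → p₁ ∘ k ≈ f → p₂ ∘ k ≈ g → k ≈ h))

  IsPullback : ∀ {A B C P} (f : A ⇒ C) (g : B ⇒ C) → P ⇒ A → P ⇒ B →
               Set (o ⊔ ℓ ⊔ e)
  IsPullback {A} {B} {C} {P} f g q₁ q₂ =
    (f ∘ q₁ ≈ g ∘ q₂) ×
    (∀ {Z} (h₁ : Z ⇒ A) (h₂ : Z ⇒ B) → f ∘ h₁ ≈ g ∘ h₂ →
      Σ[ u ∈ Z ⇒ P ] ((q₁ ∘ u ≈ h₁ × q₂ ∘ u ≈ h₂) ×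
        (∀ (k : Z ⇒ P) → q₁ ∘ k ≈ h₁ → q₂ ∘ k ≈ h₂ → k ≈ u)))

  record Pullback {A B C} (f : A ⇒ C) (g : B ⇒ C) : Set (o ⊔ ℓ ⊔ e) where
    field
      P     : Obj
      p₁    : P ⇒ A
      p₂    : P ⇒ B
      isPB  : IsPullback f g p₁ p₂

  record Product (A B : Obj) : Set (o ⊔ ℓ ⊔ e) where
    field
      A×B    : Obj
      π₁     : A×B ⇒ A
      π₂     : A×B ⇒ B
      isProd : IsProduct π₁ π₂

  record FiniteLimits : Set (o ⊔ ℓ ⊔ e) where
    field
      𝟏          : Obj
      𝟏-terminal : IsTerminal 𝟏
      product    : ∀ A B → Product A B
      pullback   : ∀ {A B C} (f : A ⇒ C) (g : B ⇒ C) → Pullback f g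

  IsImage : ∀ {A B I} → A ⇒ B → I ⇒ B → Set (o ⊔ ℓ ⊔ e)
  IsImage {A} {B} {I} f m =
    Mono m ×
    (Σ[ q ∈ A ⇒ I ] (m ∘ q ≈ f)) ×
    (∀ {J} (n : J ⇒ B) → Mono n → Σ[ k ∈ A ⇒ J ] (n ∘ k ≈ f) →
       Σ[ j ∈ I ⇒ J ] (n ∘ j ≈ m))

  record IsRegular : Set (suc (o ⊔ ℓ ⊔ e)) where
    field
      finiteLimits : FiniteLimits
      image        : ∀ {A B} (f : A ⇒ B) → Σ[ I ∈ Obj ] Σ[ m ∈ I ⇒ B ] IsImage f m
      image-stable :
        ∀ {A B I B' P Q} (f : A ⇒ B) (m : I ⇒ B) (g : B' ⇒ B)
          (f' : P ⇒ B') (g' : P ⇒ A) (m' : Q ⇒ B') (g'' : Q ⇒ I) →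
          IsImage f m → IsPullback g f f' g' → IsPullback g m m' g'' →
          IsImage f' m'
    open FiniteLimits finiteLimits public

  -- Subobjects: monos into A, compared up to isomorphism (the preorder
  -- ≤ₛ and its induced equivalence ≃ₛ)

  record Sub (A : Obj) : Set (o ⊔ ℓ ⊔ e) where
    constructor sub
    field
      {dom} : Obj
      arr   : dom ⇒ A
      mono  : Mono arr

  _≤ₛ_ : ∀ {A} → Sub A → Sub A → Set (ℓ ⊔ e)
  m ≤ₛ n = Σ[ k ∈ Sub.dom m ⇒ Sub.dom n ] (Sub.arr n ∘ k ≈ Sub.arr m)

  _≃ₛ_ : ∀ {A} → Sub A → Sub A → Set (ℓ ⊔ e)
  m ≃ₛ n = (m ≤ₛ n) × (n ≤ₛ m)

  pullback-mono : ∀ {A B C P} (f : A ⇒ C) (g : B ⇒ C) (q₁ : P ⇒ A) (q₂ : P ⇒ B) →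
                  IsPullback f g q₁ q₂ → Mono g → Mono q₁
  pullback-mono f g q₁ q₂ (comm , univ) g-mono x y q₁x≈q₁y =
    trans (u-unique x refl q₂x≈q₂y) (sym (u-unique y (sym q₁x≈q₁y) refl))
    where
      refl : ∀ {A B} {h : A ⇒ B} → h ≈ h
      refl = IsEquivalence.refl ≈-equiv
      sym : ∀ {A B} {h k : A ⇒ B} → h ≈ k → k ≈ h
      sym = IsEquivalence.sym ≈-equiv
      trans : ∀ {A B} {h k l : A ⇒ B} → h ≈ k → k ≈ l → h ≈ l
      trans = IsEquivalence.trans ≈-equiv
      q₂x≈q₂y : q₂ ∘ x ≈ q₂ ∘ y
      q₂x≈q₂y = g-mono (q₂ ∘ x) (q₂ ∘ y)
        (trans (sym assoc)
        (trans (∘-resp-≈ (sym comm) refl)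
        (trans assoc
        (trans (∘-resp-≈ refl q₁x≈q₁y)
        (trans (sym assoc)
        (trans (∘-resp-≈ comm refl) assoc))))))
      fq₁x≈gq₂y : f ∘ (q₁ ∘ x) ≈ g ∘ (q₂ ∘ y)
      fq₁x≈gq₂y = trans (sym assoc) (trans (∘-resp-≈ comm refl)
                   (trans assoc (∘-resp-≈ refl q₂x≈q₂y)))
      u-unique : ∀ k → q₁ ∘ k ≈ q₁ ∘ x → q₂ ∘ k ≈ q₂ ∘ y →
                 k ≈ proj₁ (univ (q₁ ∘ x) (q₂ ∘ y) fq₁x≈gq₂y)
      u-unique k p q = proj₂ (proj₂ (univ (q₁ ∘ x) (q₂ ∘ y) fq₁x≈gq₂y)) k p q

  module _ (fl : FiniteLimits) where
    open FiniteLimits fl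

    _^* : ∀ {A B} → A ⇒ B → Sub B → Sub A
    (f ^*) (sub m m-mono) =
      sub (Pullback.p₁ pb) (pullback-mono f m _ _ (Pullback.isPB pb) m-mono)
      where pb = pullback f m

    ⟨_,_⟩ : ∀ {Z A B} → Z ⇒ A → Z ⇒ B → Z ⇒ Product.A×B (product A B)
    ⟨ f , g ⟩ = proj₁ (Product.isProd (product _ _) f g)

    record SubEndo : Set (o ⊔ ℓ ⊔ e) where
      field
        τ       : ∀ {A} → Sub A → Sub A
        τ-resp  : ∀ {A} {m n : Sub A} → m ≃ₛ n → τ m ≃ₛ τ n
        natural : ∀ {A B} (f : A ⇒ B) (m : Sub B) → (f ^*) (τ m) ≃ₛ τ ((f ^*) m)

    VWPS : ∀ {X} → Sub (Product.A×B (product X X)) → Set (o ⊔ ℓ ⊔ e)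
    VWPS {X} R = ∀ (P : Sub X) →
      Σ[ c ∈ 𝟏 ⇒ X ] ((⟨ c , c ⟩ ^*) R ≃ₛ (c ^*) P)

-- Lawvere's diagonal argument, with the subobject functor in place of a
-- power object. Put P = τ(δ*R) for the diagonal δ = ⟨id , id⟩ and pick c
-- with ⟨c , c⟩*R ≃ c*P. Since ⟨c , c⟩ = δ ∘ c, the subobject s = ⟨c , c⟩*R
-- of 𝟏 is c*(δ*R), so naturality of τ gives τ s ≃ c*(τ(δ*R)) = c*P ≃ s.
module Submission where

open import Defs
open import Level using (_⊔_)
open import Data.Product using (Σ-syntax; _,_; proj₁; proj₂)
open import Relation.Binary using (IsEquivalence; Setoid)
import Relation.Binary.Reasoning.Setoid as SetoidReasoning

module FixedPoint {o ℓ e} (𝒞 : Category o ℓ e) (fl : FiniteLimits 𝒞) where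
  open Category 𝒞
  open FiniteLimits fl

  hom-setoid : Obj → Obj → Setoid ℓ e
  hom-setoid A B = record { isEquivalence = ≈-equiv {A} {B} }

  open module Hom {A B} = Setoid (hom-setoid A B)
    using () renaming (refl to ≈-refl; sym to ≈-sym)
  module HomReasoning {A B} = SetoidReasoning (hom-setoid A B)

  pull : ∀ {A B} → A ⇒ B → Sub 𝒞 B → Sub 𝒞 A
  pull = _^* 𝒞 fl

  pair : ∀ {Z A B} → Z ⇒ A → Z ⇒ B → Z ⇒ Product.A×B (product A B)
  pair = ⟨_,_⟩ 𝒞 fl

  ≤ₛ-refl : ∀ {A} {m : Sub 𝒞 A} → _≤ₛ_ 𝒞 m m
  ≤ₛ-refl = id , identityʳ

  ≤ₛ-trans : ∀ {A} {m n p : Sub 𝒞 A} → _≤ₛ_ 𝒞 m n → _≤ₛ_ 𝒞 n p → _≤ₛ_ 𝒞 m p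
  ≤ₛ-trans {m = m} {n} {p} (k , nk≈m) (k′ , pk′≈n) = k′ ∘ k , (begin
      Sub.arr p ∘ (k′ ∘ k)  ≈⟨ assoc ⟨
      (Sub.arr p ∘ k′) ∘ k  ≈⟨ ∘-resp-≈ pk′≈n ≈-refl ⟩
      Sub.arr n ∘ k         ≈⟨ nk≈m ⟩
      Sub.arr m             ∎)
    where open HomReasoning

  ≃ₛ-isEquivalence : ∀ {A} → IsEquivalence (_≃ₛ_ 𝒞 {A})
  ≃ₛ-isEquivalence = record
    { refl  = λ {m} → ≤ₛ-refl {m = m} , ≤ₛ-refl {m = m}
    ; sym   = λ (m≤n , n≤m) → n≤m , m≤n
    ; trans = λ {m} {n} {p} (m≤n , n≤m) (n≤p , p≤n) →
                ≤ₛ-trans {m = m} {n} {p} m≤n n≤p , ≤ₛ-trans {m = p} {n} {m} p≤n n≤m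
    }

  sub-setoid : Obj → Setoid (o ⊔ ℓ ⊔ e) (ℓ ⊔ e)
  sub-setoid A = record { isEquivalence = ≃ₛ-isEquivalence {A} }

  pull-leg : ∀ {A B} (f : A ⇒ B) (m : Sub 𝒞 B) → Sub.dom (pull f m) ⇒ Sub.dom m
  pull-leg f m = Pullback.p₂ (pullback f (Sub.arr m))

  pull-commutes : ∀ {A B} (f : A ⇒ B) (m : Sub 𝒞 B) →
                  f ∘ Sub.arr (pull f m) ≈ Sub.arr m ∘ pull-leg f m
  pull-commutes f m = proj₁ (Pullback.isPB (pullback f (Sub.arr m)))

  factors-through-pull : ∀ {A B Z} (f : A ⇒ B) (m : Sub 𝒞 B) (a : Z ⇒ A) (b : Z ⇒ Sub.dom m) →
                         f ∘ a ≈ Sub.arr m ∘ b →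
                         Σ[ k ∈ Z ⇒ Sub.dom (pull f m) ] (Sub.arr (pull f m) ∘ k ≈ a)
  factors-through-pull f m a b fa≈mb with proj₂ (Pullback.isPB (pullback f (Sub.arr m))) a b fa≈mb
  ... | k , (p₁k≈a , _) , _ = k , p₁k≈a

  pull-∘ : ∀ {A B C} {f : A ⇒ C} {g : B ⇒ C} {h : A ⇒ B} → f ≈ g ∘ h →
           (m : Sub 𝒞 C) → _≃ₛ_ 𝒞 (pull h (pull g m)) (pull f m)
  pull-∘ {A} {B} {f = f} {g} {h} f≈gh m = pasted≤direct , direct≤pasted
    where
      open HomReasoning
      q : Sub.dom (pull g m) ⇒ B
      q = Sub.arr (pull g m)
      r : Sub.dom (pull h (pull g m)) ⇒ A
      r = Sub.arr (pull h (pull g m))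
      s : Sub.dom (pull f m) ⇒ A
      s = Sub.arr (pull f m)

      pasted≤direct : _≤ₛ_ 𝒞 (pull h (pull g m)) (pull f m)
      pasted≤direct = factors-through-pull f m r (pull-leg g m ∘ pull-leg h (pull g m)) (begin
          f ∘ r                                               ≈⟨ ∘-resp-≈ f≈gh ≈-refl ⟩
          (g ∘ h) ∘ r                                         ≈⟨ assoc ⟩
          g ∘ (h ∘ r)                                         ≈⟨ ∘-resp-≈ ≈-refl (pull-commutes h (pull g m)) ⟩
          g ∘ (q ∘ pull-leg h (pull g m))                     ≈⟨ assoc ⟨
          (g ∘ q) ∘ pull-leg h (pull g m)                     ≈⟨ ∘-resp-≈ (pull-commutes g m) ≈-refl ⟩
          (Sub.arr m ∘ pull-leg g m) ∘ pull-leg h (pull g m)  ≈⟨ assoc ⟩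
          Sub.arr m ∘ (pull-leg g m ∘ pull-leg h (pull g m))  ∎)

      direct≤pasted : _≤ₛ_ 𝒞 (pull f m) (pull h (pull g m))
      direct≤pasted with factors-through-pull g m (h ∘ s) (pull-leg f m) (begin
          g ∘ (h ∘ s)               ≈⟨ assoc ⟨
          (g ∘ h) ∘ s               ≈⟨ ∘-resp-≈ f≈gh ≈-refl ⟨
          f ∘ s                     ≈⟨ pull-commutes f m ⟩
          Sub.arr m ∘ pull-leg f m  ∎)
      ... | u , qu≈hs = factors-through-pull h (pull g m) s u (≈-sym qu≈hs)

  diagonal : ∀ {X} → X ⇒ Product.A×B (product X X)
  diagonal = pair id id

  pair-diagonal : ∀ {Z X} (c : Z ⇒ X) → pair c c ≈ diagonal ∘ c
  pair-diagonal {X = X} c =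
    ≈-sym (proj₂ (proj₂ (isProd c c)) (diagonal ∘ c)
            (π-diagonal (proj₁ (proj₁ (proj₂ (isProd id id)))))
            (π-diagonal (proj₂ (proj₁ (proj₂ (isProd id id))))))
    where
      open Product (product X X)
      open HomReasoning
      π-diagonal : ∀ {π : A×B ⇒ X} → π ∘ diagonal ≈ id → π ∘ (diagonal ∘ c) ≈ c
      π-diagonal {π} πδ≈id = begin
        π ∘ (diagonal ∘ c)  ≈⟨ assoc ⟨
        (π ∘ diagonal) ∘ c  ≈⟨ ∘-resp-≈ πδ≈id ≈-refl ⟩
        id ∘ c              ≈⟨ identityˡ ⟩
        c                   ∎

  vwps⇒fixed-point : ∀ {X} (R : Sub 𝒞 (Product.A×B (product X X))) → VWPS 𝒞 fl R →
                     (T : SubEndo 𝒞 fl) → Σ[ s ∈ Sub 𝒞 𝟏 ] _≃ₛ_ 𝒞 (SubEndo.τ T s) s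
  vwps⇒fixed-point {X} R vwps T = s , (begin
      τ s                           ≈⟨ τ-resp (pull-∘ (pair-diagonal c) R) ⟨
      τ (pull c (pull diagonal R))  ≈⟨ natural c (pull diagonal R) ⟨
      pull c P                      ≈⟨ proj₂ (vwps P) ⟨
      s                             ∎)
    where
      open SubEndo T
      open SetoidReasoning (sub-setoid 𝟏)
      P : Sub 𝒞 X
      P = τ (pull diagonal R)
      c : 𝟏 ⇒ X
      c = proj₁ (vwps P)
      s : Sub 𝒞 𝟏
      s = pull (pair c c) R

lemma5 : ∀ {o ℓ e} (𝒞 : Category o ℓ e) (reg : IsRegular 𝒞)
    (X : Category.Obj 𝒞)
    (R : Sub 𝒞 (Product.A×B (FiniteLimits.product (IsRegular.finiteLimits reg) X X))) →
    VWPS 𝒞 (IsRegular.finiteLimits reg) R →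
    (T : SubEndo 𝒞 (IsRegular.finiteLimits reg)) →
    Σ[ s ∈ Sub 𝒞 (FiniteLimits.𝟏 (IsRegular.finiteLimits reg)) ]
    _≃ₛ_ 𝒞 (SubEndo.τ T s) s
lemma5 𝒞 reg X = FixedPoint.vwps⇒fixed-point 𝒞 (IsRegular.finiteLimits reg)
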